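{- For positive integers $n,k$, define $a(n,k)$ recursively by: $a(n,n)=1$; if $k$ is a proper divisor of $n$ (i.e. $k\mid n$ and $k<n$), then $a(n,k)=\sum_{m} a(m,k)$, the sum over all proper divisors $m$ of $n$; and $a(n,k)=0$ otherwise. Then for all positive integers $k$ and $n$, $$a(kn,k)=a(n,1).$$
   Context: $a(n,k)$ is the number of recursive divisors of $n$ of size $k$: writing the recursive divisor multiset $R(n)=\{n\}\uplus\biguplus_{m} R(m)$ (union over proper divisors $m$ of $n$, with $R(1)=\{1\}$), $a(n,k)$ is the multiplicity of $k$ in $R(n)$, and this multiplicity satisfies the recursion above. -}

module Defs where

open import Data.Nat using (ℕ; zero; suc; _+_; _*_; _<_; _≤_; _≟_)
open import Data.Nat.Divisibility using (_∣_; _∣?_)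
open import Data.Nat.Induction using (<-rec)
open import Data.Nat.Properties using (≤-refl; <⇒≤)
open import Relation.Nullary using (yes; no; does)
open import Data.Bool using (if_then_else_)

-- propSum n j (j ≤ n) f = Σ_{1 ≤ m < j, m ∣ n} f m.
-- Written with the bound proof so that well-founded recursion can be used:
-- f is only called on arguments m < n.
propSum : (n : ℕ) → (j : ℕ) → (j ≤ n) → ((m : ℕ) → m < n → ℕ) → ℕ
propSum n zero _ f = 0
propSum n (suc zero) _ f = 0
propSum n (suc (suc j)) sj<n f =
  (if does (suc j ∣? n) then f (suc j) sj<n else 0)
  + propSum n (suc j) (<⇒≤ sj<n) f

-- aRec k n rec : the value a(n,k), given a(m,k) for all m < n.
-- a(n,n) = 1; a(n,k) = Σ_{m proper divisor of n} a(m,k) if k ∣ n and k < n; 0 otherwise.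
-- (For positive n, "k ∣ n and k ≢ n" is the same as "k ∣ n and k < n".)
aStep : ℕ → (n : ℕ) → ((m : ℕ) → m < n → ℕ) → ℕ
aStep k n rec with k ≟ n
... | yes _ = 1
... | no  _ with k ∣? n
...   | yes _ = propSum n n ≤-refl rec
...   | no  _ = 0

a : ℕ → ℕ → ℕ
a n k = <-rec (λ _ → ℕ) (λ n rec → aStep k n (λ m m<n → rec {m} m<n)) n

{-# OPTIONS --safe #-}
module Submission where

-- The proper divisors of N·K lying above K are exactly the i·K with i a proper
-- divisor of N, and a(m,K) vanishes whenever K ∤ m.  So the recursion for
-- a(NK,K) is the recursion for a(N,1), term by term, with i·K in place of i;
-- strong induction on N finishes the argument.

open import Defs
open import Data.Bool using (if_then_else_)
open import Data.Bool.Properties using (if-eta)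
open import Data.Nat using (ℕ; zero; suc; _+_; _*_; _<_; _≤_; _≟_; s≤s)
open import Data.Nat.Divisibility
open import Data.Nat.Induction using (<-wellFounded; <-rec)
open import Data.Nat.Properties
open import Data.Empty using (⊥-elim)
open import Function using (_∘_)
open import Function.Bundles using (mk⇔)
open import Induction.WellFounded using (module FixPoint)
open import Relation.Nullary using (yes; no; does)
open import Relation.Nullary.Decidable using (does-⇔)
open import Relation.Binary.PropositionalEquality

sum< : ℕ → (ℕ → ℕ) → ℕ
sum< zero    h = 0
sum< (suc j) h = sum< j h + h j

sum<-cong : ∀ j {h g : ℕ → ℕ} → (∀ i → i < j → h i ≡ g i) → sum< j h ≡ sum< j g
sum<-cong zero    eq = refl
sum<-cong (suc j) eq = cong₂ _+_ (sum<-cong j (λ i i<j → eq i (m<n⇒m<1+n i<j))) (eq j ≤-refl)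

sum<-+ : ∀ h m n → sum< (m + n) h ≡ sum< m h + sum< n (λ i → h (m + i))
sum<-+ h m zero    rewrite +-identityʳ m = sym (+-identityʳ _)
sum<-+ h m (suc n) rewrite +-suc m n | sum<-+ h m n = +-assoc (sum< m h) _ _

sum<-head : ∀ n {h : ℕ → ℕ} → (∀ i → i < n → h (suc i) ≡ 0) → sum< (suc n) h ≡ h 0
sum<-head zero    vanish = refl
sum<-head (suc n) vanish = begin
  sum< (suc n) _ + _ ≡⟨ cong₂ _+_ (sum<-head n (λ i i<n → vanish i (m<n⇒m<1+n i<n))) (vanish n ≤-refl) ⟩
  _ + 0              ≡⟨ +-identityʳ _ ⟩
  _                  ∎
  where open ≡-Reasoning

-- Each block [jK, jK + K) contains a single multiple of K, its first element.
sum<-multiples : ∀ k {h : ℕ → ℕ} → (∀ m → suc k ∤ m → h m ≡ 0) →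
                 ∀ j → sum< (j * suc k) h ≡ sum< j (λ i → h (i * suc k))
sum<-multiples k             vanish zero    = refl
sum<-multiples k {h} vanish (suc j) = begin
  sum< (suc j * K) h                                ≡⟨ cong (λ m → sum< m h) (+-comm K (j * K)) ⟩
  sum< (j * K + K) h                                ≡⟨ sum<-+ h (j * K) K ⟩
  sum< (j * K) h + sum< K (λ i → h (j * K + i))     ≡⟨ cong₂ _+_ (sum<-multiples k vanish j)
                                                               (sum<-head k off-multiples) ⟩
  sum< j (λ i → h (i * K)) + h (j * K + 0)          ≡⟨ cong (λ m → sum< j (λ i → h (i * K)) + h m)
                                                               (+-identityʳ (j * K)) ⟩
  sum< j (λ i → h (i * K)) + h (j * K)              ∎
  where
  open ≡-Reasoning
  K = suc k
  off-multiples : ∀ i → i < k → h (j * K + suc i) ≡ 0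
  off-multiples i i<k = vanish _ λ K∣ → <⇒≱ (s≤s i<k) (∣⇒≤ (∣m+n∣m⇒∣n K∣ (n∣m*n j)))

divisorPart : ℕ → (ℕ → ℕ) → ℕ → ℕ
divisorPart n F zero    = 0
divisorPart n F (suc m) = if does (suc m ∣? n) then F (suc m) else 0

propSum-cong : ∀ n j (j≤n : j ≤ n) {f g : (m : ℕ) → m < n → ℕ} →
               (∀ m (m<n : m < n) → f m m<n ≡ g m m<n) → propSum n j j≤n f ≡ propSum n j j≤n g
propSum-cong n zero          _    eq = refl
propSum-cong n (suc zero)    _    eq = refl
propSum-cong n (suc (suc j)) j<n eq =
  cong₂ _+_ (cong (λ x → if does (suc j ∣? n) then x else 0) (eq (suc j) j<n))
            (propSum-cong n (suc j) (<⇒≤ j<n) eq)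

propSum≡sum< : ∀ n j (j≤n : j ≤ n) (F : ℕ → ℕ) → propSum n j j≤n (λ m _ → F m) ≡ sum< j (divisorPart n F)
propSum≡sum< n zero          _    F = refl
propSum≡sum< n (suc zero)    _    F = refl
propSum≡sum< n (suc (suc j)) j<n F =
  trans (+-comm (divisorPart n F (suc j)) _) (cong (_+ _) (propSum≡sum< n (suc j) (<⇒≤ j<n) F))

aStep-cong : ∀ k n {f g : (m : ℕ) → m < n → ℕ} →
             (∀ {m} (m<n : m < n) → f m m<n ≡ g m m<n) → aStep k n f ≡ aStep k n g
aStep-cong k n eq with k ≟ n
... | yes _ = refl
... | no  _ with k ∣? n
...   | yes _ = propSum-cong n n ≤-refl (λ _ → eq)
...   | no  _ = refl

a-unfold : ∀ n k → a n k ≡ aStep k n (λ m _ → a m k)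
a-unfold n k = FixPoint.unfold-wfRec <-wellFounded (λ _ → ℕ)
  (λ n rec → aStep k n (λ m m<n → rec {m} m<n)) (λ n → aStep-cong k n)

a-diag : ∀ k → a k k ≡ 1
a-diag k = trans (a-unfold k k) step
  where
  step : aStep k k (λ m _ → a m k) ≡ 1
  step with k ≟ k
  ... | yes _   = refl
  ... | no  k≢k = ⊥-elim (k≢k refl)

a-∤ : ∀ n k → k ∤ n → a n k ≡ 0
a-∤ n k k∤n = trans (a-unfold n k) step
  where
  step : aStep k n (λ m _ → a m k) ≡ 0
  step with k ≟ n
  ... | yes refl = ⊥-elim (k∤n ∣-refl)
  ... | no  _ with k ∣? n
  ...   | yes k∣n = ⊥-elim (k∤n k∣n)
  ...   | no  _   = refl

a-∣ : ∀ n k → k ≢ n → k ∣ n → a n k ≡ sum< n (divisorPart n (λ m → a m k))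
a-∣ n k k≢n k∣n = trans (a-unfold n k) (trans step (propSum≡sum< n n ≤-refl (λ m → a m k)))
  where
  step : aStep k n (λ m _ → a m k) ≡ propSum n n ≤-refl (λ m _ → a m k)
  step with k ≟ n
  ... | yes k≡n = ⊥-elim (k≢n k≡n)
  ... | no  _ with k ∣? n
  ...   | yes _   = refl
  ...   | no  k∤n = ⊥-elim (k∤n k∣n)

a-*-diag : ∀ k N → a (N * suc k) (suc k) ≡ a N 1
a-*-diag k = <-rec _ step
  where
  K = suc k
  step : ∀ N → (∀ {M} → M < N → a (M * K) K ≡ a M 1) → a (N * K) K ≡ a N 1
  step N ih with N ≟ 1
  ... | yes refl = begin
    a (1 * K) K ≡⟨ cong (λ m → a m K) (*-identityˡ K) ⟩
    a K K       ≡⟨ a-diag K ⟩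
    1           ≡⟨ sym (a-diag 1) ⟩
    a 1 1       ∎
    where open ≡-Reasoning
  ... | no N≢1 = begin
    a (N * K) K                                    ≡⟨ a-∣ (N * K) K K≢N*K (n∣m*n N) ⟩
    sum< (N * K) (divisorPart (N * K) F)           ≡⟨ sum<-multiples k non-multiple N ⟩
    sum< N (λ i → divisorPart (N * K) F (i * K))   ≡⟨ sum<-cong N scaled-term ⟩
    sum< N (divisorPart N (λ m → a m 1))           ≡⟨ sym (a-∣ N 1 (N≢1 ∘ sym) (1∣ N)) ⟩
    a N 1                                          ∎
    where
    open ≡-Reasoning
    F : ℕ → ℕ
    F m = a m K
    K≢N*K : K ≢ N * K
    K≢N*K K≡N*K = N≢1 (sym (*-cancelʳ-≡ 1 N K (trans (*-identityˡ K) K≡N*K)))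
    non-multiple : ∀ m → K ∤ m → divisorPart (N * K) F m ≡ 0
    non-multiple zero    _   = refl
    non-multiple (suc m) K∤m =
      trans (cong (λ x → if does (suc m ∣? N * K) then x else 0) (a-∤ (suc m) K K∤m)) (if-eta _)
    scaled-term : ∀ i → i < N → divisorPart (N * K) F (i * K) ≡ divisorPart N (λ m → a m 1) i
    scaled-term zero    _   = refl
    scaled-term (suc i) i<N =
      cong₂ (λ b x → if b then x else 0)
            (does-⇔ (mk⇔ (*-cancelʳ-∣ K) (*-monoˡ-∣ K)) (suc i * K ∣? N * K) (suc i ∣? N))
            (ih i<N)

lemma1 : (k n : ℕ) → a (suc k * suc n) (suc k) ≡ a (suc n) 1
lemma1 k n = trans (cong (λ m → a m (suc k)) (*-comm (suc k) (suc n))) (a-*-diag k (suc n))
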